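{- Let $k,d\in\mathbb{N}$ and let $D$ be a $(k,d)$-broom digraph with root set $R$. Let $v\in V(D)$ and suppose that there is a directed path of length at most $k$ from $v$ to a vertex of $R$. Then $d_D^+(v)=d$.
   Context: An out-arborescence is an oriented tree with a designated root such that all arcs are oriented away from the root; it is balanced if all root-to-leaf paths have the same length, and its height is the maximum length of a root-to-leaf path. For $k,d\in\mathbb{N}$, a $(k,d)$-broom rooted at $r$ is an out-arborescence $T$ with root $r$ for which there is an integer $1\le \ell\le k+1$ such that either (i) $\ell\le k$ and $T$ is a balanced out-arborescence of height $\ell$ in which every non-leaf vertex has out-degree exactly $d$; or (ii) $\ell=k+1$ and $T$ is obtained from a balanced out-arborescence of height $k+1$ in which every non-leaf vertex has out-degree exactly $d$ by subdividing each out-arc of $r$ an arbitrary number of times. Internal vertices of a broom are those that are neither the root nor a leaf. A digraph $D$ is a $(k,d)$-broom digraph with (non-empty) root set $R\subseteq V(D)$ if there are subdigraphs $(T_r)_{r\in R}$ of $D$ such that $D=\bigcup_{r\in R}T_r$; each $T_r$ is a $(k,d)$-broom rooted at $r$ all of whose leaves lie in $R$ and all of whose internal vertices lie in $V(D)\setminus R$; and $V(T_{r_1})\cap V(T_{r_2})\subseteq R$ for all distinct $r_1,r_2\in R$. -}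

module Defs where

open import Data.Nat using (ℕ; zero; suc; _≤_; _<_)
open import Data.Fin using (Fin)
open import Data.Fin.Subset using (Subset; _∈_; _∉_; ∣_∣)
open import Data.List using (List; []; _∷_; _++_)
open import Data.Vec using (Vec)
import Data.Vec as V
open import Data.Product using (_×_; _,_; ∃; Σ)
open import Data.List.Relation.Unary.All using (All)
open import Data.List.Relation.Unary.Unique.Propositional using (Unique)
open import Data.List.Membership.Propositional using () renaming (_∈_ to _∈ₗ_)
open import Relation.Binary.PropositionalEquality using (_≡_; _≢_)

-- A (finite, simple) digraph on vertex set Fin n, given by out-neighbourhoods:
-- there is an arc u → w iff  w ∈ D u.
Digraph : ℕ → Set
Digraph n = Fin n → Subset n

outdeg : ∀ {n} → Digraph n → Fin n → ℕ
outdeg D v = ∣ D v ∣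

data BTree (n d : ℕ) : ℕ → Set where
  leaf : Fin n → BTree n d 0
  node : ∀ {ℓ} → Fin n → Vec (BTree n d ℓ) d → BTree n d (suc ℓ)

rootT : ∀ {n d ℓ} → BTree n d ℓ → Fin n
rootT (leaf x)   = x
rootT (node x _) = x

mutual
  vertsT : ∀ {n d ℓ} → BTree n d ℓ → List (Fin n)
  vertsT (leaf x)    = x ∷ []
  vertsT (node x ts) = x ∷ vertsV ts

  vertsV : ∀ {n d ℓ m} → Vec (BTree n d ℓ) m → List (Fin n)
  vertsV V.[]       = []
  vertsV (t V.∷ ts) = vertsT t ++ vertsV ts

mutual
  leavesT : ∀ {n d ℓ} → BTree n d ℓ → List (Fin n)
  leavesT (leaf x)    = x ∷ []
  leavesT (node x ts) = leavesV ts

  leavesV : ∀ {n d ℓ m} → Vec (BTree n d ℓ) m → List (Fin n)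
  leavesV V.[]       = []
  leavesV (t V.∷ ts) = leavesT t ++ leavesV ts

mutual
  nonleafT : ∀ {n d ℓ} → BTree n d ℓ → List (Fin n)
  nonleafT (leaf x)    = []
  nonleafT (node x ts) = x ∷ nonleafV ts

  nonleafV : ∀ {n d ℓ m} → Vec (BTree n d ℓ) m → List (Fin n)
  nonleafV V.[]       = []
  nonleafV (t V.∷ ts) = nonleafT t ++ nonleafV ts

rootArcsV : ∀ {n d ℓ m} → Fin n → Vec (BTree n d ℓ) m → List (Fin n × Fin n)
rootArcsV x V.[]       = []
rootArcsV x (t V.∷ ts) = (x , rootT t) ∷ rootArcsV x ts

mutual
  arcsT : ∀ {n d ℓ} → BTree n d ℓ → List (Fin n × Fin n)
  arcsT (leaf x)    = []
  arcsT (node x ts) = rootArcsV x ts ++ arcsV ts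

  arcsV : ∀ {n d ℓ m} → Vec (BTree n d ℓ) m → List (Fin n × Fin n)
  arcsV V.[]       = []
  arcsV (t V.∷ ts) = arcsT t ++ arcsV ts

-- A subdivided out-arc of the root followed by a balanced tree of height k:
-- `sub x c` puts a subdivision vertex x in front.

data Chain (n d k : ℕ) : Set where
  end : BTree n d k → Chain n d k
  sub : Fin n → Chain n d k → Chain n d k

headC : ∀ {n d k} → Chain n d k → Fin n
headC (end t)   = rootT t
headC (sub x c) = x

vertsC : ∀ {n d k} → Chain n d k → List (Fin n)
vertsC (end t)   = vertsT t
vertsC (sub x c) = x ∷ vertsC c

leavesC : ∀ {n d k} → Chain n d k → List (Fin n)
leavesC (end t)   = leavesT t
leavesC (sub x c) = leavesC c

nonleafC : ∀ {n d k} → Chain n d k → List (Fin n)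
nonleafC (end t)   = nonleafT t
nonleafC (sub x c) = x ∷ nonleafC c

arcsC : ∀ {n d k} → Chain n d k → List (Fin n × Fin n)
arcsC (end t)   = arcsT t
arcsC (sub x c) = (x , headC c) ∷ arcsC c

vertsCs : ∀ {n d k m} → Vec (Chain n d k) m → List (Fin n)
vertsCs V.[]       = []
vertsCs (c V.∷ cs) = vertsC c ++ vertsCs cs

leavesCs : ∀ {n d k m} → Vec (Chain n d k) m → List (Fin n)
leavesCs V.[]       = []
leavesCs (c V.∷ cs) = leavesC c ++ leavesCs cs

nonleafCs : ∀ {n d k m} → Vec (Chain n d k) m → List (Fin n)
nonleafCs V.[]       = []
nonleafCs (c V.∷ cs) = nonleafC c ++ nonleafCs cs

arcsCs : ∀ {n d k m} → Fin n → Vec (Chain n d k) m → List (Fin n × Fin n)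
arcsCs r V.[]       = []
arcsCs r (c V.∷ cs) = (r , headC c) ∷ arcsC c ++ arcsCs r cs

-- (k,d)-brooms, as vertex-labelled trees (labels in Fin n).
--  short ℓ : case (i), a balanced d-ary tree of height ℓ+1 ≤ k, given by
--            its root and the d subtrees (height ℓ) of the root.
--  long    : case (ii), root r with d out-arcs, each subdivided an arbitrary
--            number of times, ending in a balanced d-ary tree of height k.
-- Both carry 0 < d: for d = 0 no (k,0)-broom exists (the root must be a
-- non-leaf of out-degree 0).

data Broom (n k d : ℕ) : Set where
  short : (ℓ : ℕ) → suc ℓ ≤ k → 0 < d → Fin n → Vec (BTree n d ℓ) d → Broom n k d
  long  : 0 < d → Fin n → Vec (Chain n d k) d → Broom n k d

rootB : ∀ {n k d} → Broom n k d → Fin n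
rootB (short ℓ _ _ r _) = r
rootB (long _ r _)      = r

vertsB : ∀ {n k d} → Broom n k d → List (Fin n)
vertsB (short ℓ _ _ r ts) = r ∷ vertsV ts
vertsB (long _ r cs)      = r ∷ vertsCs cs

leavesB : ∀ {n k d} → Broom n k d → List (Fin n)
leavesB (short ℓ _ _ r ts) = leavesV ts
leavesB (long _ r cs)      = leavesCs cs

internalB : ∀ {n k d} → Broom n k d → List (Fin n)
internalB (short ℓ _ _ r ts) = nonleafV ts
internalB (long _ r cs)      = nonleafCs cs

arcsB : ∀ {n k d} → Broom n k d → List (Fin n × Fin n)
arcsB (short ℓ _ _ r ts) = rootArcsV r ts ++ arcsV ts
arcsB (long _ r cs)      = arcsCs r cs

record IsBroomDigraph (k d n : ℕ) (D : Digraph n) (R : Subset n) : Set where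
  field
    R-nonempty : ∃ λ r → r ∈ R
    tree       : Fin n → Broom n k d        -- T_r (only used for r ∈ R)
    tree-root  : ∀ r → r ∈ R → rootB (tree r) ≡ r
    -- T_r is a genuine subdigraph: its labels are pairwise distinct,
    -- and all its arcs are arcs of D
    tree-inj   : ∀ r → r ∈ R → Unique (vertsB (tree r))
    tree-sub   : ∀ r → r ∈ R → ∀ {u w} → (u , w) ∈ₗ arcsB (tree r) → w ∈ D u
    leaves-R   : ∀ r → r ∈ R → All (_∈ R) (leavesB (tree r))
    internal-R : ∀ r → r ∈ R → All (_∉ R) (internalB (tree r))
    cover-V    : ∀ v → ∃ λ r → r ∈ R × v ∈ₗ vertsB (tree r)
    cover-A    : ∀ u w → w ∈ D u → ∃ λ r → r ∈ R × (u , w) ∈ₗ arcsB (tree r)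
    disjoint   : ∀ r₁ r₂ → r₁ ∈ R → r₂ ∈ R → r₁ ≢ r₂ →
                 ∀ v → v ∈ₗ vertsB (tree r₁) → v ∈ₗ vertsB (tree r₂) → v ∈ R

data Walk {n} (D : Digraph n) : Fin n → Fin n → ℕ → Set where
  []  : ∀ {u} → Walk D u u 0
  _∷_ : ∀ {u v w m} → v ∈ D u → Walk D v w m → Walk D u w (suc m)

walkVerts : ∀ {n} {D : Digraph n} {u w m} → Walk D u w m → List (Fin n)
walkVerts {u = u} []        = u ∷ []
walkVerts {u = u} (_ ∷ p)   = u ∷ walkVerts p

Path : ∀ {n} → Digraph n → Fin n → Fin n → ℕ → Set
Path D u w m = Σ (Walk D u w m) (λ p → Unique (walkVerts p))

-- Let x be the root or an internal vertex of the broom T_r.  Every arc of D leaving x lies in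
-- some broom in which x is the root or internal; as internal vertices avoid R and distinct brooms
-- meet only in R, that broom is T_r.  So x has the same out-neighbours in D as in T_r: its d
-- children, unless x subdivides an arc out of the root.  Such an x has a single out-neighbour and
-- is at distance more than k from R, because every walk from it to R first runs down the chain
-- and then through a balanced tree of height k whose non-leaf vertices avoid R.
module Submission where

open import Defs
open import Data.Nat using (ℕ; suc; _≤_; _<_; z≤n; s≤s)
open import Data.Nat.Properties using (<⇒≤; <⇒≱)
open import Data.Fin using (Fin; zero; suc; _≟_)
open import Data.Fin.Properties using (suc-injective)
open import Data.Fin.Subset using (Subset; _∈_; _∉_; ∣_∣; inside; outside)
open import Data.Fin.Subset.Properties using (_∈?_)
open import Data.List using (List; []; _∷_; _++_; map; length)
open import Data.List.Properties using (length-map)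
open import Data.List.Relation.Unary.Any using (here; there)
open import Data.List.Relation.Unary.All as All using (All; _∷_)
open import Data.List.Relation.Unary.All.Properties using (++⁻ˡ; ++⁻ʳ)
open import Data.List.Relation.Unary.AllPairs using ([]; _∷_)
open import Data.List.Relation.Unary.Unique.Propositional using (Unique)
open import Data.List.Relation.Unary.Unique.Propositional.Properties
  using (map⁺; Unique[x∷xs]⇒x∉xs)
open import Data.List.Membership.Propositional using () renaming (_∈_ to _∈ₗ_; _∉_ to _∉ₗ_)
open import Data.List.Membership.Propositional.Properties
  using (∈-++⁺ˡ; ∈-++⁺ʳ; ∈-++⁻; ∈-map⁺; ∈-map⁻)
open import Data.List.Membership.Propositional.Properties.WithK using (unique∧set⇒bag)
open import Data.List.Relation.Binary.Subset.Propositional using (_⊆_)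
open import Data.List.Relation.Binary.Subset.Propositional.Properties using (++⁺; ∷⁺ʳ)
open import Data.List.Relation.Binary.BagAndSetEquality using (∼bag⇒↭)
open import Data.List.Relation.Binary.Permutation.Propositional.Properties using (↭-length)
open import Data.Vec using (Vec; []; _∷_)
import Data.Vec as Vec
open import Data.Product using (_×_; _,_; ∃; proj₁; proj₂)
open import Data.Sum using (_⊎_; inj₁; inj₂; [_,_]′)
import Data.Sum as Sum
open import Data.Empty using (⊥-elim)
open import Function using (_∘_; id)
open import Function.Bundles using (_⇔_; mk⇔; Equivalence)
import Function.Properties.Equivalence as ⇔
open import Relation.Nullary using (yes; no)
open import Relation.Binary.PropositionalEquality using (_≡_; refl; sym; trans; cong; subst)

open Equivalence using (to; from)

elements : ∀ {n} → Subset n → List (Fin n)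
elements []            = []
elements (inside ∷ p)  = zero ∷ map suc (elements p)
elements (outside ∷ p) = map suc (elements p)

length-elements : ∀ {n} (p : Subset n) → length (elements p) ≡ ∣ p ∣
length-elements []            = refl
length-elements (inside ∷ p)  = cong suc (trans (length-map suc (elements p)) (length-elements p))
length-elements (outside ∷ p) = trans (length-map suc (elements p)) (length-elements p)

zero∉map-suc : ∀ {n} {xs : List (Fin n)} → zero ∉ₗ map suc xs
zero∉map-suc z∈ with ∈-map⁻ suc z∈
... | _ , _ , ()

elements-unique : ∀ {n} (p : Subset n) → Unique (elements p)
elements-unique []            = []
elements-unique (inside ∷ p)  =
  All.tabulate (λ { z∈ refl → zero∉map-suc z∈ }) ∷ map⁺ suc-injective (elements-unique p)
elements-unique (outside ∷ p) = map⁺ suc-injective (elements-unique p)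

∈⇔∈-elements : ∀ {n} (p : Subset n) {x} → x ∈ p ⇔ x ∈ₗ elements p
∈⇔∈-elements p = mk⇔ (∈-elements⁺ p) (∈-elements⁻ p)
  where
  ∈-elements⁺ : ∀ {n} (p : Subset n) {x} → x ∈ p → x ∈ₗ elements p
  ∈-elements⁺ (inside ∷ p)  Vec.here        = here refl
  ∈-elements⁺ (inside ∷ p)  (Vec.there x∈p) = there (∈-map⁺ suc (∈-elements⁺ p x∈p))
  ∈-elements⁺ (outside ∷ p) (Vec.there x∈p) = ∈-map⁺ suc (∈-elements⁺ p x∈p)

  ∈-elements⁻ : ∀ {n} (p : Subset n) {x} → x ∈ₗ elements p → x ∈ p
  ∈-elements⁻ (inside ∷ p) (here refl) = Vec.here
  ∈-elements⁻ (inside ∷ p) (there x∈) with ∈-map⁻ suc x∈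
  ... | _ , y∈ , refl = Vec.there (∈-elements⁻ p y∈)
  ∈-elements⁻ (outside ∷ p) x∈ with ∈-map⁻ suc x∈
  ... | _ , y∈ , refl = Vec.there (∈-elements⁻ p y∈)

∣p∣≡length : ∀ {n} {p : Subset n} {xs : List (Fin n)} → Unique xs →
             (∀ {x} → x ∈ p ⇔ x ∈ₗ xs) → ∣ p ∣ ≡ length xs
∣p∣≡length {p = p} xs! p⇔xs = trans (sym (length-elements p))
  (↭-length (∼bag⇒↭ (unique∧set⇒bag (elements-unique p) xs!
    (⇔.trans (⇔.sym (∈⇔∈-elements p)) p⇔xs))))

module _ {A : Set} where

  Unique-++⁻ˡ : ∀ (xs : List A) {ys} → Unique (xs ++ ys) → Unique xs
  Unique-++⁻ˡ []       _          = []
  Unique-++⁻ˡ (x ∷ xs) (x∉ ∷ xs!) = ++⁻ˡ xs x∉ ∷ Unique-++⁻ˡ xs xs!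

  Unique-++⁻ʳ : ∀ (xs : List A) {ys} → Unique (xs ++ ys) → Unique ys
  Unique-++⁻ʳ []       ys!       = ys!
  Unique-++⁻ʳ (x ∷ xs) (_ ∷ xs!) = Unique-++⁻ʳ xs xs!

  Unique-++⇒∉ : ∀ (xs : List A) {ys x} → Unique (xs ++ ys) → x ∈ₗ xs → x ∉ₗ ys
  Unique-++⇒∉ (x ∷ xs) (x∉ ∷ _)   (here refl) x∈ys = All.lookup x∉ (∈-++⁺ʳ xs x∈ys) refl
  Unique-++⇒∉ (x ∷ xs) (_  ∷ xs!) (there x∈)  x∈ys = Unique-++⇒∉ xs xs! x∈ x∈ys

module _ {n d : ℕ} where

  rootsV : ∀ {ℓ m} → Vec (BTree n d ℓ) m → List (Fin n)
  rootsV []       = []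
  rootsV (t ∷ ts) = rootT t ∷ rootsV ts

  length-rootsV : ∀ {ℓ m} (ts : Vec (BTree n d ℓ) m) → length (rootsV ts) ≡ m
  length-rootsV []       = refl
  length-rootsV (t ∷ ts) = cong suc (length-rootsV ts)

  rootT∈vertsT : ∀ {ℓ} (t : BTree n d ℓ) → rootT t ∈ₗ vertsT t
  rootT∈vertsT (leaf x)   = here refl
  rootT∈vertsT (node x _) = here refl

  rootsV⊆vertsV : ∀ {ℓ m} (ts : Vec (BTree n d ℓ) m) → rootsV ts ⊆ vertsV ts
  rootsV⊆vertsV (t ∷ ts) (here refl) = ∈-++⁺ˡ (rootT∈vertsT t)
  rootsV⊆vertsV (t ∷ ts) (there y∈)  = ∈-++⁺ʳ (vertsT t) (rootsV⊆vertsV ts y∈)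

  rootsV-unique : ∀ {ℓ m} (ts : Vec (BTree n d ℓ) m) → Unique (vertsV ts) → Unique (rootsV ts)
  rootsV-unique []       _  = []
  rootsV-unique (t ∷ ts) u =
    All.tabulate (λ { y∈ refl →
      Unique-++⇒∉ (vertsT t) u (rootT∈vertsT t) (rootsV⊆vertsV ts y∈) })
    ∷ rootsV-unique ts (Unique-++⁻ʳ (vertsT t) u)

  ∈-rootArcsV⁺ : ∀ {ℓ m} x (ts : Vec (BTree n d ℓ) m) {w} →
                 w ∈ₗ rootsV ts → (x , w) ∈ₗ rootArcsV x ts
  ∈-rootArcsV⁺ x (t ∷ ts) (here refl) = here refl
  ∈-rootArcsV⁺ x (t ∷ ts) (there w∈)  = there (∈-rootArcsV⁺ x ts w∈)

  ∈-rootArcsV⁻ : ∀ {ℓ m} x (ts : Vec (BTree n d ℓ) m) {u w} →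
                 (u , w) ∈ₗ rootArcsV x ts → u ≡ x × w ∈ₗ rootsV ts
  ∈-rootArcsV⁻ x (t ∷ ts) (here refl) = refl , here refl
  ∈-rootArcsV⁻ x (t ∷ ts) (there a∈)  with ∈-rootArcsV⁻ x ts a∈
  ... | refl , w∈ = refl , there w∈

  mutual
    nonleafT⊆vertsT : ∀ {ℓ} (t : BTree n d ℓ) → nonleafT t ⊆ vertsT t
    nonleafT⊆vertsT (node x ts) = ∷⁺ʳ x (nonleafV⊆vertsV ts)

    nonleafV⊆vertsV : ∀ {ℓ m} (ts : Vec (BTree n d ℓ) m) → nonleafV ts ⊆ vertsV ts
    nonleafV⊆vertsV []       ()
    nonleafV⊆vertsV (t ∷ ts) = ++⁺ (nonleafT⊆vertsT t) (nonleafV⊆vertsV ts)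

  mutual
    arcsT-source : ∀ {ℓ} (t : BTree n d ℓ) {u w} → (u , w) ∈ₗ arcsT t → u ∈ₗ nonleafT t
    arcsT-source (node x ts) a∈ with ∈-++⁻ (rootArcsV x ts) a∈
    ... | inj₁ a∈₁ with ∈-rootArcsV⁻ x ts a∈₁
    ...   | refl , _ = here refl
    arcsT-source (node x ts) a∈ | inj₂ a∈₂ = there (arcsV-source ts a∈₂)

    arcsV-source : ∀ {ℓ m} (ts : Vec (BTree n d ℓ) m) {u w} →
                   (u , w) ∈ₗ arcsV ts → u ∈ₗ nonleafV ts
    arcsV-source (t ∷ ts) a∈ with ∈-++⁻ (arcsT t) a∈
    ... | inj₁ a∈₁ = ∈-++⁺ˡ (arcsT-source t a∈₁)
    ... | inj₂ a∈₂ = ∈-++⁺ʳ (nonleafT t) (arcsV-source ts a∈₂)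

  mutual
    vertsT-split : ∀ {ℓ} (t : BTree n d ℓ) {v} →
                   v ∈ₗ vertsT t → v ∈ₗ nonleafT t ⊎ v ∈ₗ leavesT t
    vertsT-split (leaf x)    v∈          = inj₂ v∈
    vertsT-split (node x ts) (here refl) = inj₁ (here refl)
    vertsT-split (node x ts) (there v∈)  = Sum.map₁ there (vertsV-split ts v∈)

    vertsV-split : ∀ {ℓ m} (ts : Vec (BTree n d ℓ) m) {v} →
                   v ∈ₗ vertsV ts → v ∈ₗ nonleafV ts ⊎ v ∈ₗ leavesV ts
    vertsV-split (t ∷ ts) v∈ with ∈-++⁻ (vertsT t) v∈
    ... | inj₁ v∈₁ = Sum.map ∈-++⁺ˡ ∈-++⁺ˡ (vertsT-split t v∈₁)
    ... | inj₂ v∈₂ =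
      Sum.map (∈-++⁺ʳ (nonleafT t)) (∈-++⁺ʳ (leavesT t)) (vertsV-split ts v∈₂)

  module _ {k : ℕ} where

    headsCs : ∀ {m} → Vec (Chain n d k) m → List (Fin n)
    headsCs []       = []
    headsCs (c ∷ cs) = headC c ∷ headsCs cs

    length-headsCs : ∀ {m} (cs : Vec (Chain n d k) m) → length (headsCs cs) ≡ m
    length-headsCs []       = refl
    length-headsCs (c ∷ cs) = cong suc (length-headsCs cs)

    headC∈vertsC : (c : Chain n d k) → headC c ∈ₗ vertsC c
    headC∈vertsC (end t)   = rootT∈vertsT t
    headC∈vertsC (sub x c) = here refl

    headsCs⊆vertsCs : ∀ {m} (cs : Vec (Chain n d k) m) → headsCs cs ⊆ vertsCs cs
    headsCs⊆vertsCs (c ∷ cs) (here refl) = ∈-++⁺ˡ (headC∈vertsC c)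
    headsCs⊆vertsCs (c ∷ cs) (there y∈)  = ∈-++⁺ʳ (vertsC c) (headsCs⊆vertsCs cs y∈)

    headsCs-unique : ∀ {m} (cs : Vec (Chain n d k) m) → Unique (vertsCs cs) → Unique (headsCs cs)
    headsCs-unique []       _ = []
    headsCs-unique (c ∷ cs) u =
      All.tabulate (λ { y∈ refl →
        Unique-++⇒∉ (vertsC c) u (headC∈vertsC c) (headsCs⊆vertsCs cs y∈) })
      ∷ headsCs-unique cs (Unique-++⁻ʳ (vertsC c) u)

    nonleafC⊆vertsC : (c : Chain n d k) → nonleafC c ⊆ vertsC c
    nonleafC⊆vertsC (end t)   = nonleafT⊆vertsT t
    nonleafC⊆vertsC (sub x c) = ∷⁺ʳ x (nonleafC⊆vertsC c)

    nonleafCs⊆vertsCs : ∀ {m} (cs : Vec (Chain n d k) m) → nonleafCs cs ⊆ vertsCs cs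
    nonleafCs⊆vertsCs []       ()
    nonleafCs⊆vertsCs (c ∷ cs) = ++⁺ (nonleafC⊆vertsC c) (nonleafCs⊆vertsCs cs)

    arcsC-source : (c : Chain n d k) {u w : Fin n} → (u , w) ∈ₗ arcsC c → u ∈ₗ nonleafC c
    arcsC-source (end t)   a∈          = arcsT-source t a∈
    arcsC-source (sub x c) (here refl) = here refl
    arcsC-source (sub x c) (there a∈)  = there (arcsC-source c a∈)

    arcsCs-source : ∀ {m} r (cs : Vec (Chain n d k) m) {u w} →
                    (u , w) ∈ₗ arcsCs r cs → u ≡ r ⊎ u ∈ₗ nonleafCs cs
    arcsCs-source r (c ∷ cs) (here refl) = inj₁ refl
    arcsCs-source r (c ∷ cs) (there a∈) with ∈-++⁻ (arcsC c) a∈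
    ... | inj₁ a∈₁ = inj₂ (∈-++⁺ˡ (arcsC-source c a∈₁))
    ... | inj₂ a∈₂ = Sum.map₂ (∈-++⁺ʳ (nonleafC c)) (arcsCs-source r cs a∈₂)

    ∈-arcsCs⁺ : ∀ {m} r (cs : Vec (Chain n d k) m) {w} →
                w ∈ₗ headsCs cs → (r , w) ∈ₗ arcsCs r cs
    ∈-arcsCs⁺ r (c ∷ cs) (here refl) = here refl
    ∈-arcsCs⁺ r (c ∷ cs) (there w∈)  = there (∈-++⁺ʳ (arcsC c) (∈-arcsCs⁺ r cs w∈))

    ∈-arcsCs⁻ : ∀ {m} r (cs : Vec (Chain n d k) m) {w} → r ∉ₗ vertsCs cs →
                (r , w) ∈ₗ arcsCs r cs → w ∈ₗ headsCs cs
    ∈-arcsCs⁻ r (c ∷ cs) r∉ (here refl) = here refl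
    ∈-arcsCs⁻ r (c ∷ cs) r∉ (there a∈) with ∈-++⁻ (arcsC c) a∈
    ... | inj₁ a∈₁ = ⊥-elim (r∉ (∈-++⁺ˡ (nonleafC⊆vertsC c (arcsC-source c a∈₁))))
    ... | inj₂ a∈₂ = there (∈-arcsCs⁻ r cs (r∉ ∘ ∈-++⁺ʳ (vertsC c)) a∈₂)

    vertsC-split : (c : Chain n d k) {v : Fin n} →
                   v ∈ₗ vertsC c → v ∈ₗ nonleafC c ⊎ v ∈ₗ leavesC c
    vertsC-split (end t)   v∈          = vertsT-split t v∈
    vertsC-split (sub x c) (here refl) = inj₁ (here refl)
    vertsC-split (sub x c) (there v∈)  = Sum.map₁ there (vertsC-split c v∈)

    vertsCs-split : ∀ {m} (cs : Vec (Chain n d k) m) {v} →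
                    v ∈ₗ vertsCs cs → v ∈ₗ nonleafCs cs ⊎ v ∈ₗ leavesCs cs
    vertsCs-split (c ∷ cs) v∈ with ∈-++⁻ (vertsC c) v∈
    ... | inj₁ v∈₁ = Sum.map ∈-++⁺ˡ ∈-++⁺ˡ (vertsC-split c v∈₁)
    ... | inj₂ v∈₂ =
      Sum.map (∈-++⁺ʳ (nonleafC c)) (∈-++⁺ʳ (leavesC c)) (vertsCs-split cs v∈₂)

module _ {n k d : ℕ} where

  rootB∈vertsB : (T : Broom n k d) → rootB T ∈ₗ vertsB T
  rootB∈vertsB (short _ _ _ r ts) = here refl
  rootB∈vertsB (long _ r cs)      = here refl

  internalB⊆vertsB : (T : Broom n k d) → internalB T ⊆ vertsB T
  internalB⊆vertsB (short _ _ _ r ts) = there ∘ nonleafV⊆vertsV ts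
  internalB⊆vertsB (long _ r cs)      = there ∘ nonleafCs⊆vertsCs cs

  arcsB-source : (T : Broom n k d) {u w : Fin n} →
                 (u , w) ∈ₗ arcsB T → u ≡ rootB T ⊎ u ∈ₗ internalB T
  arcsB-source (short _ _ _ r ts) a∈ with ∈-++⁻ (rootArcsV r ts) a∈
  ... | inj₁ a∈₁ = inj₁ (proj₁ (∈-rootArcsV⁻ r ts a∈₁))
  ... | inj₂ a∈₂ = inj₂ (arcsV-source ts a∈₂)
  arcsB-source (long _ r cs) a∈ = arcsCs-source r cs a∈

  vertsB-split : (T : Broom n k d) {v : Fin n} → v ∈ₗ vertsB T →
                 v ≡ rootB T ⊎ v ∈ₗ internalB T ⊎ v ∈ₗ leavesB T
  vertsB-split (short _ _ _ r ts) (here refl) = inj₁ refl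
  vertsB-split (short _ _ _ r ts) (there v∈)  = inj₂ (vertsV-split ts v∈)
  vertsB-split (long _ r cs)      (here refl) = inj₁ refl
  vertsB-split (long _ r cs)      (there v∈)  = inj₂ (vertsCs-split cs v∈)

module _ {n : ℕ} (D : Digraph n) where

  OutArcs : Fin n → List (Fin n × Fin n) → Set
  OutArcs x A = ∀ {w} → w ∈ D x ⇔ (x , w) ∈ₗ A

  OutArcs-++⁻ˡ : ∀ {x} A {B} → OutArcs x (A ++ B) → (∀ {w} → (x , w) ∉ₗ B) → OutArcs x A
  OutArcs-++⁻ˡ A out x∉B =
    mk⇔ ([ id , ⊥-elim ∘ x∉B ]′ ∘ ∈-++⁻ A ∘ to out) (from out ∘ ∈-++⁺ˡ)

  OutArcs-++⁻ʳ : ∀ {x} A {B} → OutArcs x (A ++ B) → (∀ {w} → (x , w) ∉ₗ A) → OutArcs x B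
  OutArcs-++⁻ʳ A out x∉A =
    mk⇔ ([ ⊥-elim ∘ x∉A , id ]′ ∘ ∈-++⁻ A ∘ to out) (from out ∘ ∈-++⁺ʳ A)

  module _ {d : ℕ} where

    children-node : ∀ {ℓ m x} (ts : Vec (BTree n d ℓ) m) → x ∉ₗ vertsV ts →
                    OutArcs x (rootArcsV x ts ++ arcsV ts) →
                    ∀ {w} → w ∈ D x ⇔ w ∈ₗ rootsV ts
    children-node {x = x} ts x∉ out = mk⇔
      ([ proj₂ ∘ ∈-rootArcsV⁻ x ts , ⊥-elim ∘ x∉ ∘ nonleafV⊆vertsV ts ∘ arcsV-source ts ]′
         ∘ ∈-++⁻ (rootArcsV x ts) ∘ to out)
      (from out ∘ ∈-++⁺ˡ ∘ ∈-rootArcsV⁺ x ts)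

    outdeg-node : ∀ {ℓ x} (ts : Vec (BTree n d ℓ) d) → Unique (x ∷ vertsV ts) →
                  OutArcs x (rootArcsV x ts ++ arcsV ts) → outdeg D x ≡ d
    outdeg-node ts u@(_ ∷ ts!) out =
      trans (∣p∣≡length (rootsV-unique ts ts!)
                        (children-node ts (Unique[x∷xs]⇒x∉xs u) out))
            (length-rootsV ts)

    children-long-root : ∀ {k m r} (cs : Vec (Chain n d k) m) → r ∉ₗ vertsCs cs →
                         OutArcs r (arcsCs r cs) → ∀ {w} → w ∈ D r ⇔ w ∈ₗ headsCs cs
    children-long-root {r = r} cs r∉ out =
      mk⇔ (∈-arcsCs⁻ r cs r∉ ∘ to out) (from out ∘ ∈-arcsCs⁺ r cs)

    outdeg-long-root : ∀ {k r} (cs : Vec (Chain n d k) d) → Unique (r ∷ vertsCs cs) →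
                       OutArcs r (arcsCs r cs) → outdeg D r ≡ d
    outdeg-long-root cs u@(_ ∷ cs!) out =
      trans (∣p∣≡length (headsCs-unique cs cs!)
                        (children-long-root cs (Unique[x∷xs]⇒x∉xs u) out))
            (length-headsCs cs)

    outdeg-rootB : ∀ {k} (T : Broom n k d) → Unique (vertsB T) → OutArcs (rootB T) (arcsB T) →
                   outdeg D (rootB T) ≡ d
    outdeg-rootB (short _ _ _ r ts) = outdeg-node ts
    outdeg-rootB (long _ r cs)      = outdeg-long-root cs

module _ {n : ℕ} (D : Digraph n) (R : Subset n) where

  -- V, I and A are the vertices, the non-leaf vertices and the arcs of a part of a broom.
  Faithful : List (Fin n) → List (Fin n) → List (Fin n × Fin n) → Set
  Faithful V I A = Unique V × All (_∉ R) I × (∀ {x} → x ∈ₗ I → OutArcs D x A)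

  Faithful-++⁻ : ∀ V₁ {V₂} I₁ {I₂} A₁ {A₂} → Faithful (V₁ ++ V₂) (I₁ ++ I₂) (A₁ ++ A₂) →
                 (∀ {x w} → x ∈ₗ I₁ → (x , w) ∉ₗ A₂) →
                 (∀ {x w} → x ∈ₗ I₂ → (x , w) ∉ₗ A₁) →
                 Faithful V₁ I₁ A₁ × Faithful V₂ I₂ A₂
  Faithful-++⁻ V₁ I₁ A₁ (u , I∉R , out) I₁#A₂ I₂#A₁ =
    (Unique-++⁻ˡ V₁ u , ++⁻ˡ I₁ I∉R ,
     λ x∈ → OutArcs-++⁻ˡ D A₁ (out (∈-++⁺ˡ x∈)) (I₁#A₂ x∈)) ,
    (Unique-++⁻ʳ V₁ u , ++⁻ʳ I₁ I∉R ,
     λ x∈ → OutArcs-++⁻ʳ D A₁ (out (∈-++⁺ʳ I₁ x∈)) (I₂#A₁ x∈))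

  Faithful-dropArcs : ∀ A₀ {V I A} → Faithful V I (A₀ ++ A) →
                      (∀ {x w} → x ∈ₗ I → (x , w) ∉ₗ A₀) → Faithful V I A
  Faithful-dropArcs A₀ (u , I∉R , out) I#A₀ =
    u , I∉R , λ x∈ → OutArcs-++⁻ʳ D A₀ (out x∈) (I#A₀ x∈)

  module _ {d : ℕ} where

    FaithfulT : ∀ {ℓ} → BTree n d ℓ → Set
    FaithfulT t = Faithful (vertsT t) (nonleafT t) (arcsT t)

    FaithfulV : ∀ {ℓ m} → Vec (BTree n d ℓ) m → Set
    FaithfulV ts = Faithful (vertsV ts) (nonleafV ts) (arcsV ts)

    FaithfulV-root⁻ : ∀ {ℓ m x} (ts : Vec (BTree n d ℓ) m) →
                      Faithful (x ∷ vertsV ts) (nonleafV ts) (rootArcsV x ts ++ arcsV ts) →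
                      FaithfulV ts
    FaithfulV-root⁻ {x = x} ts (u@(_ ∷ ts!) , I∉R , out) =
      Faithful-dropArcs (rootArcsV x ts) (ts! , I∉R , out) λ y∈ a∈ →
        Unique[x∷xs]⇒x∉xs u
          (subst (_∈ₗ vertsV ts) (proj₁ (∈-rootArcsV⁻ x ts a∈)) (nonleafV⊆vertsV ts y∈))

    FaithfulT-node⁻ : ∀ {ℓ} x (ts : Vec (BTree n d ℓ) d) →
                      FaithfulT (node x ts) → FaithfulV ts
    FaithfulT-node⁻ x ts (u , _ ∷ I∉R , out) = FaithfulV-root⁻ ts (u , I∉R , out ∘ there)

    FaithfulV-∷⁻ : ∀ {ℓ m} (t : BTree n d ℓ) (ts : Vec (BTree n d ℓ) m) →
                   FaithfulV (t ∷ ts) → FaithfulT t × FaithfulV ts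
    FaithfulV-∷⁻ t ts f@(u , _) = Faithful-++⁻ (vertsT t) (nonleafT t) (arcsT t) f
      (λ x∈ a∈ → Unique-++⇒∉ (vertsT t) u (nonleafT⊆vertsT t x∈)
                                            (nonleafV⊆vertsV ts (arcsV-source ts a∈)))
      (λ x∈ a∈ → Unique-++⇒∉ (vertsT t) u (nonleafT⊆vertsT t (arcsT-source t a∈))
                                            (nonleafV⊆vertsV ts x∈))

    mutual
      height≤walkT : ∀ {ℓ} (t : BTree n d ℓ) → FaithfulT t →
                     ∀ {w m} → Walk D (rootT t) w m → w ∈ R → ℓ ≤ m
      height≤walkT (leaf x)    _                    _       _   = z≤n
      height≤walkT (node x ts) (_ , x∉R ∷ _ , _)    []      w∈R = ⊥-elim (x∉R w∈R)
      height≤walkT (node x ts) f@(u , _ , out)      (e ∷ q) w∈R =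
        s≤s (height≤walkV ts (FaithfulT-node⁻ x ts f)
              (to (children-node D ts (Unique[x∷xs]⇒x∉xs u) (out (here refl))) e) q w∈R)

      height≤walkV : ∀ {ℓ m} (ts : Vec (BTree n d ℓ) m) → FaithfulV ts →
                     ∀ {y w m′} → y ∈ₗ rootsV ts → Walk D y w m′ → w ∈ R → ℓ ≤ m′
      height≤walkV (t ∷ ts) f (here refl) = height≤walkT t (proj₁ (FaithfulV-∷⁻ t ts f))
      height≤walkV (t ∷ ts) f (there y∈)  =
        height≤walkV ts (proj₂ (FaithfulV-∷⁻ t ts f)) y∈

    mutual
      outdeg-nonleafT : ∀ {ℓ} (t : BTree n d ℓ) → FaithfulT t →
                        ∀ {x} → x ∈ₗ nonleafT t → outdeg D x ≡ d
      outdeg-nonleafT (node x ts) (u , _ , out) (here refl) = outdeg-node D ts u (out (here refl))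
      outdeg-nonleafT (node x ts) f             (there x∈)  =
        outdeg-nonleafV ts (FaithfulT-node⁻ x ts f) x∈

      outdeg-nonleafV : ∀ {ℓ m} (ts : Vec (BTree n d ℓ) m) → FaithfulV ts →
                        ∀ {x} → x ∈ₗ nonleafV ts → outdeg D x ≡ d
      outdeg-nonleafV (t ∷ ts) f x∈ with ∈-++⁻ (nonleafT t) x∈
      ... | inj₁ x∈₁ = outdeg-nonleafT t (proj₁ (FaithfulV-∷⁻ t ts f)) x∈₁
      ... | inj₂ x∈₂ = outdeg-nonleafV ts (proj₂ (FaithfulV-∷⁻ t ts f)) x∈₂

    module _ {k : ℕ} where

      FaithfulC : Chain n d k → Set
      FaithfulC c = Faithful (vertsC c) (nonleafC c) (arcsC c)

      FaithfulCs : ∀ {m} → Fin n → Vec (Chain n d k) m → Set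
      FaithfulCs r cs = r ∉ₗ vertsCs cs × Faithful (vertsCs cs) (nonleafCs cs) (arcsCs r cs)

      FaithfulC-sub⁻ : ∀ x c → FaithfulC (sub x c) → FaithfulC c
      FaithfulC-sub⁻ x c (u@(_ ∷ c!) , _ ∷ I∉R , out) =
        Faithful-dropArcs ((x , headC c) ∷ []) (c! , I∉R , out ∘ there)
          λ { y∈ (here refl) → Unique[x∷xs]⇒x∉xs u (nonleafC⊆vertsC c y∈) }

      FaithfulCs-∷⁻ : ∀ {m} r c (cs : Vec (Chain n d k) m) →
                      FaithfulCs r (c ∷ cs) → FaithfulC c × FaithfulCs r cs
      FaithfulCs-∷⁻ r c cs (r∉ , f@(u , _)) =
        Faithful-dropArcs ((r , headC c) ∷ []) (proj₁ split) (λ { x∈ (here refl) → r∉ (inC x∈) }) ,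
        r∉ ∘ ∈-++⁺ʳ (vertsC c) , proj₂ split
        where
        inC : nonleafC c ⊆ vertsC c ++ vertsCs cs
        inC = ∈-++⁺ˡ ∘ nonleafC⊆vertsC c

        inCs : nonleafCs cs ⊆ vertsC c ++ vertsCs cs
        inCs = ∈-++⁺ʳ (vertsC c) ∘ nonleafCs⊆vertsCs cs

        apart : ∀ {x} → x ∈ₗ nonleafC c → x ∉ₗ nonleafCs cs
        apart x∈ = Unique-++⇒∉ (vertsC c) u (nonleafC⊆vertsC c x∈) ∘ nonleafCs⊆vertsCs cs

        split : Faithful (vertsC c) (nonleafC c) ((r , headC c) ∷ arcsC c) ×
                Faithful (vertsCs cs) (nonleafCs cs) (arcsCs r cs)
        split = Faithful-++⁻ (vertsC c) (nonleafC c) ((r , headC c) ∷ arcsC c) f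
          (λ x∈ a∈ → [ (λ { refl → r∉ (inC x∈) }) , apart x∈ ]′ (arcsCs-source r cs a∈))
          (λ { x∈ (here refl) → r∉ (inCs x∈) ; x∈ (there a∈) → apart (arcsC-source c a∈) x∈ })

      child-sub : ∀ x c → FaithfulC (sub x c) → ∀ {y} → y ∈ D x → y ≡ headC c
      child-sub x c (u , _ , out) e with to (out (here refl)) e
      ... | here refl = refl
      ... | there a∈  =
        ⊥-elim (Unique[x∷xs]⇒x∉xs u (nonleafC⊆vertsC c (arcsC-source c a∈)))

      mutual
        height≤walkC : (c : Chain n d k) → FaithfulC c →
                       ∀ {w m} → Walk D (headC c) w m → w ∈ R → k ≤ m
        height≤walkC (end t)   f q w∈R = height≤walkT t f q w∈R
        height≤walkC (sub x c) f q w∈R = <⇒≤ (height<walk-sub x c f q w∈R)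

        height<walk-sub : ∀ x c → FaithfulC (sub x c) →
                          ∀ {w m} → Walk D x w m → w ∈ R → k < m
        height<walk-sub x c (_ , x∉R ∷ _ , _) []      w∈R = ⊥-elim (x∉R w∈R)
        height<walk-sub x c f                 (e ∷ q) w∈R with child-sub x c f e
        ... | refl = s≤s (height≤walkC c (FaithfulC-sub⁻ x c f) q w∈R)

      outdeg-nonleafC : (c : Chain n d k) → FaithfulC c → ∀ {x w m} → x ∈ₗ nonleafC c →
                        Walk D x w m → w ∈ R → m ≤ k → outdeg D x ≡ d
      outdeg-nonleafC (end t)   f x∈          _ _   _   = outdeg-nonleafT t f x∈
      outdeg-nonleafC (sub x c) f (here refl) q w∈R m≤k =
        ⊥-elim (<⇒≱ (height<walk-sub x c f q w∈R) m≤k)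
      outdeg-nonleafC (sub x c) f (there x∈)  q w∈R m≤k =
        outdeg-nonleafC c (FaithfulC-sub⁻ x c f) x∈ q w∈R m≤k

      outdeg-nonleafCs : ∀ {m′} r (cs : Vec (Chain n d k) m′) → FaithfulCs r cs → ∀ {x w m} →
                         x ∈ₗ nonleafCs cs → Walk D x w m → w ∈ R → m ≤ k → outdeg D x ≡ d
      outdeg-nonleafCs r (c ∷ cs) f x∈ with FaithfulCs-∷⁻ r c cs f | ∈-++⁻ (nonleafC c) x∈
      ... | fc , _   | inj₁ x∈₁ = outdeg-nonleafC c fc x∈₁
      ... | _  , fcs | inj₂ x∈₂ = outdeg-nonleafCs r cs fcs x∈₂

    FaithfulB : ∀ {k} → Broom n k d → Set
    FaithfulB T = Faithful (vertsB T) (internalB T) (arcsB T)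

    outdeg-internalB : ∀ {k} (T : Broom n k d) → FaithfulB T → ∀ {v w m} → v ∈ₗ internalB T →
                       Walk D v w m → w ∈ R → m ≤ k → outdeg D v ≡ d
    outdeg-internalB (short _ _ _ r ts) f v∈ _ _ _ = outdeg-nonleafV ts (FaithfulV-root⁻ ts f) v∈
    outdeg-internalB (long _ r cs) (u@(_ ∷ cs!) , rest) =
      outdeg-nonleafCs r cs (Unique[x∷xs]⇒x∉xs u , cs! , rest)

module _ {k d n : ℕ} {D : Digraph n} {R : Subset n} (B : IsBroomDigraph k d n D R) where
  open IsBroomDigraph B

  core : Fin n → List (Fin n)
  core r = rootB (tree r) ∷ internalB (tree r)

  core⊆vertsB : ∀ r → core r ⊆ vertsB (tree r)
  core⊆vertsB r (here refl) = rootB∈vertsB (tree r)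
  core⊆vertsB r (there x∈)  = internalB⊆vertsB (tree r) x∈

  core∩R-root : ∀ {r x} → r ∈ R → x ∈ₗ core r → x ∈ R → x ≡ r
  core∩R-root r∈R (here refl) _   = tree-root _ r∈R
  core∩R-root r∈R (there x∈)  x∈R = ⊥-elim (All.lookup (internal-R _ r∈R) x∈ x∈R)

  core-disjoint : ∀ {r₁ r₂ x} → r₁ ∈ R → r₂ ∈ R →
                  x ∈ₗ core r₁ → x ∈ₗ core r₂ → r₁ ≡ r₂
  core-disjoint {r₁} {r₂} {x} r₁∈R r₂∈R x∈₁ x∈₂ with r₁ ≟ r₂
  ... | yes r₁≡r₂ = r₁≡r₂
  ... | no  r₁≢r₂ = trans (sym (core∩R-root r₁∈R x∈₁ x∈R)) (core∩R-root r₂∈R x∈₂ x∈R)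
    where
    x∈R : x ∈ R
    x∈R = disjoint r₁ r₂ r₁∈R r₂∈R r₁≢r₂ x (core⊆vertsB r₁ x∈₁) (core⊆vertsB r₂ x∈₂)

  outArcs-core : ∀ {r x} → r ∈ R → x ∈ₗ core r → OutArcs D x (arcsB (tree r))
  outArcs-core {r} {x} r∈R x∈ = mk⇔ arc-of-tree (tree-sub r r∈R)
    where
    arc-of-tree : ∀ {w} → w ∈ D x → (x , w) ∈ₗ arcsB (tree r)
    arc-of-tree {w} e with cover-A x w e
    ... | r′ , r′∈R , a∈
      with core-disjoint r∈R r′∈R x∈ ([ here , there ]′ (arcsB-source (tree r′) a∈))
    ...   | refl = a∈

  faithful-tree : ∀ {r} → r ∈ R → FaithfulB D R (tree r)
  faithful-tree {r} r∈R = tree-inj r r∈R , internal-R r r∈R , outArcs-core r∈R ∘ there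

  internal-if-∉R : ∀ {r v} → r ∈ R → v ∈ₗ vertsB (tree r) → v ∉ R →
                   v ∈ₗ internalB (tree r)
  internal-if-∉R {r} r∈R v∈ v∉R with vertsB-split (tree r) v∈
  ... | inj₁ refl        = ⊥-elim (v∉R (subst (_∈ R) (sym (tree-root r r∈R)) r∈R))
  ... | inj₂ (inj₁ v∈I)  = v∈I
  ... | inj₂ (inj₂ v∈L)  = ⊥-elim (v∉R (All.lookup (leaves-R r r∈R) v∈L))

  outdeg-root : ∀ {r} → r ∈ R → outdeg D r ≡ d
  outdeg-root {r} r∈R = subst (λ x → outdeg D x ≡ d) (tree-root r r∈R)
    (outdeg-rootB D (tree r) (tree-inj r r∈R) (outArcs-core r∈R (here refl)))

  outdeg-∉R : ∀ {v w m} → v ∉ R → Walk D v w m → w ∈ R → m ≤ k → outdeg D v ≡ d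
  outdeg-∉R {v} v∉R with cover-V v
  ... | r , r∈R , v∈ =
    outdeg-internalB D R (tree r) (faithful-tree r∈R) (internal-if-∉R r∈R v∈ v∉R)

lemma2p3 : (k d n : ℕ) (D : Digraph n) (R : Subset n) → IsBroomDigraph k d n D R →
    (v : Fin n) → (∃ λ w → ∃ λ m → m ≤ k × w ∈ R × Path D v w m) →
    outdeg D v ≡ d
lemma2p3 k d n D R B v (w , m , m≤k , w∈R , walk , _) with v ∈? R
... | yes v∈R = outdeg-root B v∈R
... | no  v∉R = outdeg-∉R B v∉R walk w∈R m≤k
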